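{- Let $A[1..n]$ be an array in which each element is a predecessor or a successor, and in which the number of successors is at least the number of predecessors. The Preprocessing Phase applied to $A$ has work $O(n)$ and span $O(\log n)$, and at the end of the Preprocessing Phase every prefix of $A$ is successor-heavy.
   Context: Parallel model: algorithms use parallel-for-loops and recursion; work is the running time on one processor, span the running time on infinitely many processors (a parallel-for-loop whose iterations each have span $s$ has span $s+O(1)$); deciding whether an element is a predecessor takes $O(1)$ time. A prefix $A[1],\dots,A[t]$ is successor-heavy if it contains at least $t/4$ successors. Preprocessing Phase on $A[1..n]$: in parallel for each $i=1,\dots,\lfloor n/2\rfloor$, if $A[i]$ is a predecessor and $A[n-i+1]$ is a successor, swap them; then recursively perform the Preprocessing Phase on $A[1],\dots,A[\lceil n/2\rceil]$. -}

module Defs where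

open import Data.Bool using (Bool; true; false; if_then_else_; _∧_)
open import Data.Nat using (ℕ; zero; suc; _+_; _∸_; _≤ᵇ_; _<ᵇ_; ⌊_/2⌋; ⌈_/2⌉)

data Elem : Set where
  predecessor successor : Elem

isPred : Elem → Bool
isPred predecessor = true
isPred successor   = false

isSucc : Elem → Bool
isSucc predecessor = false
isSucc successor   = true

-- An array A[1..n] is modelled as a function ℕ → Elem; only the positions
-- 1,…,n are meaningful (index 0 and indices > n are ignored / left untouched).
Array : Set
Array = ℕ → Elem

countSucc : Array → ℕ → ℕ
countSucc A zero    = 0
countSucc A (suc t) = countSucc A t + (if isSucc (A (suc t)) then 1 else 0)

countPred : Array → ℕ → ℕ
countPred A zero    = 0
countPred A (suc t) = countPred A t + (if isPred (A (suc t)) then 1 else 0)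

SuccessorHeavy : Array → ℕ → Set
SuccessorHeavy A t = t Data.Nat.≤ 4 Data.Nat.* countSucc A t

-- One parallel swap round on A[1..n]: for each i = 1,…,⌊n/2⌋ (in parallel),
-- if A[i] is a predecessor and A[n-i+1] is a successor, swap them.
-- The pairs {i, n-i+1} are disjoint, so the round is a well-defined function.
swapCond : Array → ℕ → ℕ → Bool
swapCond A i k = isPred (A i) ∧ isSucc (A k)

swapRound : ℕ → Array → Array
swapRound n A j =
  if (1 ≤ᵇ j) ∧ (j ≤ᵇ ⌊ n /2⌋) ∧ swapCond A j (suc n ∸ j)
    then A (suc n ∸ j)
  else if (⌈ n /2⌉ <ᵇ j) ∧ (j ≤ᵇ n) ∧ swapCond A (suc n ∸ j) j
    then A (suc n ∸ j)
  else A j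

-- Fuel n suffices since the recursion depth is ≤ n.
preprocessFuel : ℕ → ℕ → Array → Array
preprocessFuel zero     n A = A
preprocessFuel (suc f)  n A =
  if n ≤ᵇ 1 then A else preprocessFuel f ⌈ n /2⌉ (swapRound n A)

preprocess : ℕ → Array → Array
preprocess n A = preprocessFuel n n A

-- Cost model (unit costs). A parallel-for over ⌊n/2⌋ iterations, each doing
-- O(1) work (two predecessor tests and possibly a swap), followed by the
-- recursive call.
workFuel : ℕ → ℕ → ℕ
workFuel zero    n = 1
workFuel (suc f) n = if n ≤ᵇ 1 then 1 else (⌊ n /2⌋ + 1) + workFuel f ⌈ n /2⌉

spanFuel : ℕ → ℕ → ℕ
spanFuel zero    n = 1
spanFuel (suc f) n = if n ≤ᵇ 1 then 1 else 2 + spanFuel f ⌈ n /2⌉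

work : ℕ → ℕ
work n = workFuel n n

span : ℕ → ℕ
span n = spanFuel n n

-- Pair position i with its mirror n+1-i. A swap round keeps the number of
-- successors in every pair, and afterwards the left member of a pair holding
-- a successor is a successor. So the round preserves the successor count of
-- A[1..n] and leaves at least half of that count in A[1..⌈n/2⌉]: if at least
-- half of A[1..n] are successors, then at least half of A[1..⌈n/2⌉] are, and
-- this invariant passes to the recursive call. The recursion never touches
-- positions beyond ⌈n/2⌉ and keeps the count of A[1..⌈n/2⌉], so a prefix of
-- length t > ⌈n/2⌉ contains at least ⌈n/2⌉/2 ≥ n/4 ≥ t/4 successors, while
-- shorter prefixes are handled by induction.
module Submission where

open import Defs
open import Data.Bool using (true; false; if_then_else_; _∧_)
open import Data.Nat
  using (ℕ; zero; suc; _+_; _*_; _∸_; _^_; _≤_; _<_; z≤n; s≤s; ⌊_/2⌋; ⌈_/2⌉; _≤ᵇ_; _<ᵇ_; _≤?_)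
open import Data.Nat.Properties
open import Algebra.Properties.CommutativeSemigroup +-commutativeSemigroup
  using () renaming (interchange to +-interchange)
open import Data.Nat.Induction using (<-rec)
open import Data.Nat.Logarithm using (⌊log₂_⌋; ⌊log₂⌋-mono-≤; ⌊log₂⌊n/2⌋⌋≡⌊log₂n⌋∸1)
open import Data.Nat.Solver using (module +-*-Solver)
open import Data.Product using (_×_; ∃; _,_)
open import Data.Sum using (inj₁; inj₂)
open import Relation.Nullary using (yes; no)
open import Relation.Nullary.Reflects using (ofʸ; ofⁿ; det)
open import Relation.Binary.PropositionalEquality
open +-*-Solver using (solve; _:+_; _:=_; con)

≤ᵇ-true : ∀ {m n} → m ≤ n → (m ≤ᵇ n) ≡ true
≤ᵇ-true {m} {n} m≤n = det (≤ᵇ-reflects-≤ m n) (ofʸ m≤n)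

≤ᵇ-false : ∀ {m n} → n < m → (m ≤ᵇ n) ≡ false
≤ᵇ-false {m} {n} n<m = det (≤ᵇ-reflects-≤ m n) (ofⁿ (<⇒≱ n<m))

<ᵇ-true : ∀ {m n} → m < n → (m <ᵇ n) ≡ true
<ᵇ-true {m} {n} m<n = det (<ᵇ-reflects-< m n) (ofʸ m<n)

<ᵇ-false : ∀ {m n} → n ≤ m → (m <ᵇ n) ≡ false
<ᵇ-false {m} {n} n≤m = det (<ᵇ-reflects-< m n) (ofⁿ (≤⇒≯ n≤m))

⌈2*n/2⌉≡n : ∀ n → ⌈ 2 * n /2⌉ ≡ n
⌈2*n/2⌉≡n n = sym (trans (n≡⌈n+n/2⌉ n) (cong (λ k → ⌈ n + k /2⌉) (sym (+-identityʳ n))))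

n≤2*m⇒⌈n/2⌉≤m : ∀ {n m} → n ≤ 2 * m → ⌈ n /2⌉ ≤ m
n≤2*m⇒⌈n/2⌉≤m {n} {m} n≤2m = subst (⌈ n /2⌉ ≤_) (⌈2*n/2⌉≡n m) (⌈n/2⌉-mono n≤2m)

n≤⌈n/2⌉+⌈n/2⌉ : ∀ n → n ≤ ⌈ n /2⌉ + ⌈ n /2⌉
n≤⌈n/2⌉+⌈n/2⌉ n =
  subst (_≤ ⌈ n /2⌉ + ⌈ n /2⌉) (⌊n/2⌋+⌈n/2⌉≡n n) (+-monoˡ-≤ ⌈ n /2⌉ (⌊n/2⌋≤⌈n/2⌉ n))

n<2*[1+⌊n/2⌋] : ∀ n → n < 2 * suc ⌊ n /2⌋
n<2*[1+⌊n/2⌋] zero          = s≤s z≤n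
n<2*[1+⌊n/2⌋] (suc zero)    = s≤s (s≤s z≤n)
n<2*[1+⌊n/2⌋] (suc (suc n)) =
  subst (suc (suc n) <_) (sym (*-suc 2 (suc ⌊ n /2⌋))) (s≤s (s≤s (n<2*[1+⌊n/2⌋] n)))

n<2^[1+⌊log₂n⌋] : ∀ n → n < 2 ^ suc ⌊log₂ n ⌋
n<2^[1+⌊log₂n⌋] = <-rec (λ n → n < 2 ^ suc ⌊log₂ n ⌋) bound
  where
  bound : ∀ n → (∀ {k} → k < n → k < 2 ^ suc ⌊log₂ k ⌋) → n < 2 ^ suc ⌊log₂ n ⌋
  bound zero       _   = s≤s z≤n
  bound (suc zero) _   = s≤s (s≤s z≤n)
  bound n@(suc (suc k)) rec = <-≤-trans (n<2*[1+⌊n/2⌋] n) (*-monoʳ-≤ 2 ⌊n/2⌋<2^⌊log₂n⌋)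
    where
    1≤⌊log₂n⌋ : 1 ≤ ⌊log₂ n ⌋
    1≤⌊log₂n⌋ = ⌊log₂⌋-mono-≤ {2} {n} (s≤s (s≤s z≤n))
    ⌊n/2⌋<2^⌊log₂n⌋ : ⌊ n /2⌋ < 2 ^ ⌊log₂ n ⌋
    ⌊n/2⌋<2^⌊log₂n⌋ =
      subst (λ e → ⌊ n /2⌋ < 2 ^ e)
            (trans (cong suc (⌊log₂⌊n/2⌋⌋≡⌊log₂n⌋∸1 n)) (m+[n∸m]≡n 1≤⌊log₂n⌋))
            (rec (⌊n/2⌋<n (suc k)))

sumTo : (ℕ → ℕ) → ℕ → ℕ
sumTo F zero    = 0
sumTo F (suc d) = sumTo F d + F (suc d)

sumTo-cong : ∀ {F G} d → (∀ {i} → 1 ≤ i → i ≤ d → F i ≡ G i) → sumTo F d ≡ sumTo G d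
sumTo-cong zero    F≡G = refl
sumTo-cong (suc d) F≡G =
  cong₂ _+_ (sumTo-cong d (λ 1≤i i≤d → F≡G 1≤i (m≤n⇒m≤1+n i≤d))) (F≡G (s≤s z≤n) ≤-refl)

sumTo-mono-≤ : ∀ {F G} d → (∀ {i} → 1 ≤ i → i ≤ d → F i ≤ G i) → sumTo F d ≤ sumTo G d
sumTo-mono-≤ zero    F≤G = z≤n
sumTo-mono-≤ (suc d) F≤G =
  +-mono-≤ (sumTo-mono-≤ d (λ 1≤i i≤d → F≤G 1≤i (m≤n⇒m≤1+n i≤d))) (F≤G (s≤s z≤n) ≤-refl)

sumTo-distrib-+ : ∀ F G d → sumTo (λ i → F i + G i) d ≡ sumTo F d + sumTo G d
sumTo-distrib-+ F G zero    = refl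
sumTo-distrib-+ F G (suc d) rewrite sumTo-distrib-+ F G d =
  +-interchange (sumTo F d) (sumTo G d) (F (suc d)) (G (suc d))

sumTo-peel : ∀ F d → sumTo F (suc d) ≡ F 1 + sumTo (λ i → F (suc i)) d
sumTo-peel F zero    = +-comm 0 (F 1)
sumTo-peel F (suc d) rewrite sumTo-peel F d = +-assoc (F 1) _ _

sumTo-split : ∀ F a d → sumTo F (a + d) ≡ sumTo F a + sumTo (λ i → F (a + i)) d
sumTo-split F a zero    rewrite +-identityʳ a = sym (+-identityʳ _)
sumTo-split F a (suc d) rewrite +-suc a d | sumTo-split F a d = +-assoc (sumTo F a) _ _

sumTo-split-reverse : ∀ F {a d n} → a + d ≡ n →
  sumTo F n ≡ sumTo F a + sumTo (λ i → F (suc n ∸ i)) d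
sumTo-split-reverse F {a} {d} refl = split-reverse d
  where
  split-reverse : ∀ d → sumTo F (a + d) ≡ sumTo F a + sumTo (λ i → F (suc (a + d) ∸ i)) d
  split-reverse zero    rewrite +-identityʳ a = sym (+-identityʳ _)
  split-reverse (suc d)
    rewrite +-suc a d
          | sumTo-peel (λ i → F (suc (suc (a + d)) ∸ i)) d
          | split-reverse d =
    trans (+-assoc (sumTo F a) _ _) (cong (sumTo F a +_) (+-comm _ (F (suc (a + d)))))

-- For odd n the middle position ⌈n/2⌉ has no partner; for even n the middle sum is empty.
pairSum : (ℕ → ℕ) → ℕ → ℕ
pairSum F n = sumTo (λ i → F i + F (suc n ∸ i)) ⌊ n /2⌋

middleSum : (ℕ → ℕ) → ℕ → ℕ
middleSum F n = sumTo (λ i → F (⌊ n /2⌋ + i)) (⌈ n /2⌉ ∸ ⌊ n /2⌋)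

sumTo-⌈n/2⌉ : ∀ F n → sumTo F ⌈ n /2⌉ ≡ sumTo F ⌊ n /2⌋ + middleSum F n
sumTo-⌈n/2⌉ F n =
  trans (cong (sumTo F) (sym (m+[n∸m]≡n (⌊n/2⌋≤⌈n/2⌉ n)))) (sumTo-split F ⌊ n /2⌋ _)

sumTo-pairs : ∀ F n → sumTo F n ≡ pairSum F n + middleSum F n
sumTo-pairs F n = begin
    sumTo F n
  ≡⟨ sumTo-split-reverse F {h} {m} h+m≡n ⟩
    sumTo F h + sumTo F̃ m
  ≡⟨ cong (_+ sumTo F̃ m) (sumTo-⌈n/2⌉ F n) ⟩
    (sumTo F m + middleSum F n) + sumTo F̃ m
  ≡⟨ +-assoc (sumTo F m) _ _ ⟩
    sumTo F m + (middleSum F n + sumTo F̃ m)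
  ≡⟨ cong (sumTo F m +_) (+-comm (middleSum F n) _) ⟩
    sumTo F m + (sumTo F̃ m + middleSum F n)
  ≡⟨ sym (+-assoc (sumTo F m) _ _) ⟩
    (sumTo F m + sumTo F̃ m) + middleSum F n
  ≡⟨ cong (_+ middleSum F n) (sym (sumTo-distrib-+ F F̃ m)) ⟩
    pairSum F n + middleSum F n
  ∎
  where
  open ≡-Reasoning
  m = ⌊ n /2⌋
  h = ⌈ n /2⌉
  h+m≡n : h + m ≡ n
  h+m≡n = trans (+-comm h m) (⌊n/2⌋+⌈n/2⌉≡n n)
  F̃ : ℕ → ℕ
  F̃ i = F (suc n ∸ i)

middleSum-cong : ∀ {F G} n → (∀ {j} → ⌊ n /2⌋ < j → j ≤ ⌈ n /2⌉ → F j ≡ G j) →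
                 middleSum F n ≡ middleSum G n
middleSum-cong n F≡G = sumTo-cong _ λ {i} 1≤i i≤d →
  F≡G (subst (_≤ ⌊ n /2⌋ + i) (+-comm ⌊ n /2⌋ 1) (+-monoʳ-≤ ⌊ n /2⌋ 1≤i))
      (subst (⌊ n /2⌋ + i ≤_) (m+[n∸m]≡n (⌊n/2⌋≤⌈n/2⌉ n)) (+-monoʳ-≤ ⌊ n /2⌋ i≤d))

#succ : Elem → ℕ
#succ e = if isSucc e then 1 else 0

countSucc≡sumTo : ∀ A t → countSucc A t ≡ sumTo (λ j → #succ (A j)) t
countSucc≡sumTo A zero    = refl
countSucc≡sumTo A (suc t) = cong (_+ #succ (A (suc t))) (countSucc≡sumTo A t)

countSucc-mono : ∀ A {t u} → t ≤ u → countSucc A t ≤ countSucc A u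
countSucc-mono A {u = zero}  z≤n = ≤-refl
countSucc-mono A {u = suc u} t≤1+u with m≤n⇒m<n∨m≡n t≤1+u
... | inj₂ refl      = ≤-refl
... | inj₁ (s≤s t≤u) = ≤-trans (countSucc-mono A t≤u) (m≤m+n _ _)

countPred+countSucc≡n : ∀ A n → countPred A n + countSucc A n ≡ n
countPred+countSucc≡n A zero = refl
countPred+countSucc≡n A (suc n) with A (suc n)
... | predecessor rewrite +-identityʳ (countSucc A n) | +-comm (countPred A n) 1 =
  cong suc (countPred+countSucc≡n A n)
... | successor rewrite +-identityʳ (countPred A n) | +-comm (countSucc A n) 1 =
  trans (+-suc (countPred A n) _) (cong suc (countPred+countSucc≡n A n))

countSucc-agree-above : ∀ X Y {h} N → h ≤ N → countSucc X h ≡ countSucc Y h →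
  (∀ {j} → h < j → j ≤ N → X j ≡ Y j) → countSucc X N ≡ countSucc Y N
countSucc-agree-above X Y zero    z≤n   X≡Y agree = X≡Y
countSucc-agree-above X Y (suc N) h≤1+N X≡Y agree with m≤n⇒m<n∨m≡n h≤1+N
... | inj₂ refl      = X≡Y
... | inj₁ (s≤s h≤N) =
  cong₂ _+_ (countSucc-agree-above X Y N h≤N X≡Y (λ h<j j≤N → agree h<j (m≤n⇒m≤1+n j≤N)))
            (cong #succ (agree (s≤s h≤N) ≤-refl))

HalfSuccessors : Array → ℕ → Set
HalfSuccessors A n = n ≤ 2 * countSucc A n

balanced⇒HalfSuccessors : ∀ A n → countPred A n ≤ countSucc A n → HalfSuccessors A n
balanced⇒HalfSuccessors A n p≤s =
  subst (_≤ 2 * countSucc A n) (countPred+countSucc≡n A n)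
        (subst (countPred A n + countSucc A n ≤_)
               (cong (countSucc A n +_) (sym (+-identityʳ _)))
               (+-monoˡ-≤ (countSucc A n) p≤s))

swappedFst swappedSnd : Elem → Elem → Elem
swappedFst a b = if isPred a ∧ isSucc b then b else a
swappedSnd a b = if isPred a ∧ isSucc b then a else b

#succ-swapped : ∀ a b → #succ (swappedFst a b) + #succ (swappedSnd a b) ≡ #succ a + #succ b
#succ-swapped predecessor predecessor = refl
#succ-swapped predecessor successor   = refl
#succ-swapped successor   predecessor = refl
#succ-swapped successor   successor   = refl

#succ-≤-swappedFst : ∀ a b → #succ a + #succ b ≤ #succ (swappedFst a b) + #succ (swappedFst a b)
#succ-≤-swappedFst predecessor predecessor = z≤n
#succ-≤-swappedFst predecessor successor   = s≤s z≤n
#succ-≤-swappedFst successor   predecessor = s≤s z≤n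
#succ-≤-swappedFst successor   successor   = ≤-refl

⌈n/2⌉<1+n∸i : ∀ {n i} → i ≤ ⌊ n /2⌋ → ⌈ n /2⌉ < suc n ∸ i
⌈n/2⌉<1+n∸i {n} {i} i≤m = subst (_≤ suc n ∸ i) 1+n∸⌊n/2⌋≡1+⌈n/2⌉ (∸-monoʳ-≤ (suc n) i≤m)
  where
  1+n∸⌊n/2⌋≡1+⌈n/2⌉ : suc n ∸ ⌊ n /2⌋ ≡ suc ⌈ n /2⌉
  1+n∸⌊n/2⌋≡1+⌈n/2⌉ = begin
    suc n ∸ ⌊ n /2⌋                     ≡⟨ +-∸-assoc 1 (⌊n/2⌋≤n n) ⟩
    suc (n ∸ ⌊ n /2⌋)                   ≡⟨ cong (λ e → suc (e ∸ ⌊ n /2⌋)) (sym (⌊n/2⌋+⌈n/2⌉≡n n)) ⟩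
    suc (⌊ n /2⌋ + ⌈ n /2⌉ ∸ ⌊ n /2⌋)   ≡⟨ cong suc (m+n∸m≡n ⌊ n /2⌋ ⌈ n /2⌉) ⟩
    suc ⌈ n /2⌉                         ∎
    where open ≡-Reasoning

module _ {n : ℕ} (A : Array) where

  swapRound-left : ∀ {i} → 1 ≤ i → i ≤ ⌊ n /2⌋ →
                   swapRound n A i ≡ swappedFst (A i) (A (suc n ∸ i))
  swapRound-left {i} 1≤i i≤m
    rewrite ≤ᵇ-true 1≤i | ≤ᵇ-true i≤m | <ᵇ-false {⌈ n /2⌉} (≤-trans i≤m (⌊n/2⌋≤⌈n/2⌉ n)) = refl

  swapRound-right : ∀ {i} → 1 ≤ i → i ≤ ⌊ n /2⌋ →
                    swapRound n A (suc n ∸ i) ≡ swappedSnd (A i) (A (suc n ∸ i))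
  swapRound-right {i} 1≤i i≤m
    rewrite ≤ᵇ-true (≤-trans (s≤s z≤n) (⌈n/2⌉<1+n∸i i≤m))
          | ≤ᵇ-false (≤-<-trans (⌊n/2⌋≤⌈n/2⌉ n) (⌈n/2⌉<1+n∸i i≤m))
          | <ᵇ-true (⌈n/2⌉<1+n∸i i≤m) | ≤ᵇ-true (∸-monoʳ-≤ (suc n) 1≤i)
          | m∸[m∸n]≡n (≤-trans i≤m (≤-trans (⌊n/2⌋≤n n) (n≤1+n n))) = refl

  swapRound-middle : ∀ {j} → ⌊ n /2⌋ < j → j ≤ ⌈ n /2⌉ → swapRound n A j ≡ A j
  swapRound-middle {j} m<j j≤h
    rewrite ≤ᵇ-true {1} {j} (≤-trans (s≤s z≤n) m<j) | ≤ᵇ-false m<j | <ᵇ-false j≤h = refl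

  swapRound-beyond : ∀ {j} → n < j → swapRound n A j ≡ A j
  swapRound-beyond {j} n<j
    rewrite ≤ᵇ-true {1} {j} (≤-trans (s≤s z≤n) n<j) | ≤ᵇ-false {j} {⌊ n /2⌋} (≤-<-trans (⌊n/2⌋≤n n) n<j)
          | <ᵇ-true {⌈ n /2⌉} {j} (≤-<-trans (⌈n/2⌉≤n n) n<j) | ≤ᵇ-false n<j = refl

module _ (n : ℕ) (A : Array) where
  private
    B = swapRound n A
    F G : ℕ → ℕ
    F j = #succ (A j)
    G j = #succ (B j)

    middle-unchanged : middleSum G n ≡ middleSum F n
    middle-unchanged = middleSum-cong n λ m<j j≤h → cong #succ (swapRound-middle A m<j j≤h)

  swapRound-countSucc : countSucc B n ≡ countSucc A n
  swapRound-countSucc = begin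
      countSucc B n
    ≡⟨ trans (countSucc≡sumTo B n) (sumTo-pairs G n) ⟩
      pairSum G n + middleSum G n
    ≡⟨ cong₂ _+_ (sumTo-cong ⌊ n /2⌋ pair-unchanged) middle-unchanged ⟩
      pairSum F n + middleSum F n
    ≡⟨ sym (trans (countSucc≡sumTo A n) (sumTo-pairs F n)) ⟩
      countSucc A n
    ∎
    where
    open ≡-Reasoning
    pair-unchanged : ∀ {i} → 1 ≤ i → i ≤ ⌊ n /2⌋ → G i + G (suc n ∸ i) ≡ F i + F (suc n ∸ i)
    pair-unchanged 1≤i i≤m rewrite swapRound-left A 1≤i i≤m | swapRound-right A 1≤i i≤m =
      #succ-swapped (A _) (A _)

  countSucc-≤-swapRound-⌈n/2⌉ : countSucc A n ≤ countSucc B ⌈ n /2⌉ + countSucc B ⌈ n /2⌉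
  countSucc-≤-swapRound-⌈n/2⌉ = begin
      countSucc A n
    ≡⟨ trans (countSucc≡sumTo A n) (sumTo-pairs F n) ⟩
      pairSum F n + middleSum F n
    ≤⟨ +-monoˡ-≤ _ (sumTo-mono-≤ ⌊ n /2⌋ pair-≤-double) ⟩
      sumTo (λ i → G i + G i) ⌊ n /2⌋ + middleSum F n
    ≤⟨ +-mono-≤ (≤-reflexive (sumTo-distrib-+ G G ⌊ n /2⌋)) (≤-reflexive (sym middle-unchanged)) ⟩
      (sumTo G ⌊ n /2⌋ + sumTo G ⌊ n /2⌋) + middleSum G n
    ≤⟨ +-monoʳ-≤ (sumTo G ⌊ n /2⌋ + sumTo G ⌊ n /2⌋) (m≤m+n (middleSum G n) (middleSum G n)) ⟩
      (sumTo G ⌊ n /2⌋ + sumTo G ⌊ n /2⌋) + (middleSum G n + middleSum G n)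
    ≡⟨ +-interchange (sumTo G ⌊ n /2⌋) (sumTo G ⌊ n /2⌋) (middleSum G n) (middleSum G n) ⟩
      (sumTo G ⌊ n /2⌋ + middleSum G n) + (sumTo G ⌊ n /2⌋ + middleSum G n)
    ≡⟨ sym (cong₂ _+_ countSucc-⌈n/2⌉ countSucc-⌈n/2⌉) ⟩
      countSucc B ⌈ n /2⌉ + countSucc B ⌈ n /2⌉
    ∎
    where
    open ≤-Reasoning
    pair-≤-double : ∀ {i} → 1 ≤ i → i ≤ ⌊ n /2⌋ → F i + F (suc n ∸ i) ≤ G i + G i
    pair-≤-double 1≤i i≤m rewrite swapRound-left A 1≤i i≤m = #succ-≤-swappedFst (A _) (A _)
    countSucc-⌈n/2⌉ : countSucc B ⌈ n /2⌉ ≡ sumTo G ⌊ n /2⌋ + middleSum G n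
    countSucc-⌈n/2⌉ = trans (countSucc≡sumTo B ⌈ n /2⌉) (sumTo-⌈n/2⌉ G n)

  swapRound-HalfSuccessors : HalfSuccessors A n → HalfSuccessors B ⌈ n /2⌉
  swapRound-HalfSuccessors half = ≤-trans (n≤2*m⇒⌈n/2⌉≤m half)
    (subst (countSucc A n ≤_) (cong (countSucc B ⌈ n /2⌉ +_) (sym (+-identityʳ _)))
           countSucc-≤-swapRound-⌈n/2⌉)

preprocessFuel-beyond : ∀ f n A {j} → n < j → preprocessFuel f n A j ≡ A j
preprocessFuel-beyond zero          n             A n<j = refl
preprocessFuel-beyond (suc f)       zero          A n<j = refl
preprocessFuel-beyond (suc f)       (suc zero)    A n<j = refl
preprocessFuel-beyond (suc f) n@(suc (suc _)) A n<j =
  trans (preprocessFuel-beyond f ⌈ n /2⌉ (swapRound n A) (≤-<-trans (⌈n/2⌉≤n n) n<j))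
        (swapRound-beyond A n<j)

preprocessFuel-countSucc : ∀ f n A → countSucc (preprocessFuel f n A) n ≡ countSucc A n
preprocessFuel-countSucc zero          n             A = refl
preprocessFuel-countSucc (suc f)       zero          A = refl
preprocessFuel-countSucc (suc f)       (suc zero)    A = refl
preprocessFuel-countSucc (suc f) n@(suc (suc _)) A =
  trans (countSucc-agree-above _ (swapRound n A) n (⌈n/2⌉≤n n)
           (preprocessFuel-countSucc f ⌈ n /2⌉ (swapRound n A))
           (λ h<j _ → preprocessFuel-beyond f ⌈ n /2⌉ (swapRound n A) h<j))
        (swapRound-countSucc n A)

preprocessFuel-successorHeavy : ∀ f n A → n ≤ f → HalfSuccessors A n →
  ∀ t → t ≤ n → SuccessorHeavy (preprocessFuel f n A) t
preprocessFuel-successorHeavy f n A _ _ zero _ = z≤n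
preprocessFuel-successorHeavy f zero A _ _ (suc t) ()
preprocessFuel-successorHeavy zero (suc n) A () _ _ _
preprocessFuel-successorHeavy (suc f) (suc zero) A _ half (suc zero) _ =
  ≤-trans half (*-monoˡ-≤ (countSucc A 1) {2} {4} (s≤s (s≤s z≤n)))
preprocessFuel-successorHeavy (suc f) (suc zero) A _ _ (suc (suc t)) (s≤s ())
preprocessFuel-successorHeavy (suc f) n@(suc (suc k)) A (s≤s n≤1+f) half t t≤n
  with t ≤? ⌈ n /2⌉
... | yes t≤h = preprocessFuel-successorHeavy f h B h≤f (swapRound-HalfSuccessors n A half) t t≤h
  where
  h = ⌈ n /2⌉
  B = swapRound n A
  h≤f : h ≤ f
  h≤f = ≤-pred (≤-trans (⌈n/2⌉<n k) (s≤s n≤1+f))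
... | no t≰h = begin
    t                    ≤⟨ t≤n ⟩
    n                    ≤⟨ n≤⌈n/2⌉+⌈n/2⌉ n ⟩
    h + h                ≤⟨ +-mono-≤ halfB halfB ⟩
    2 * c + 2 * c        ≡⟨ sym (*-distribʳ-+ c 2 2) ⟩
    4 * c                ≡⟨ cong (4 *_) (sym (preprocessFuel-countSucc f h B)) ⟩
    4 * countSucc R h    ≤⟨ *-monoʳ-≤ 4 (countSucc-mono R (<⇒≤ (≰⇒> t≰h))) ⟩
    4 * countSucc R t    ∎
  where
  open ≤-Reasoning
  h = ⌈ n /2⌉
  B = swapRound n A
  R = preprocessFuel f h B
  c = countSucc B h
  halfB : h ≤ 2 * c
  halfB = swapRound-HalfSuccessors n A half

workFuel≤1+n+n : ∀ f n → workFuel f n ≤ suc (n + n)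
workFuel≤1+n+n zero          n          = s≤s z≤n
workFuel≤1+n+n (suc f)       zero       = ≤-refl
workFuel≤1+n+n (suc f)       (suc zero) = s≤s z≤n
workFuel≤1+n+n (suc f) n@(suc (suc k)) = begin
    (m + 1) + workFuel f h  ≤⟨ +-monoʳ-≤ (m + 1) (workFuel≤1+n+n f h) ⟩
    (m + 1) + suc (h + h)   ≡⟨ regroup m h ⟩
    suc ((m + h) + suc h)   ≡⟨ cong (λ e → suc (e + suc h)) (⌊n/2⌋+⌈n/2⌉≡n n) ⟩
    suc (n + suc h)         ≤⟨ s≤s (+-monoʳ-≤ n (⌈n/2⌉<n k)) ⟩
    suc (n + n)             ∎
  where
  open ≤-Reasoning
  m = ⌊ n /2⌋
  h = ⌈ n /2⌉
  regroup : ∀ a b → (a + 1) + suc (b + b) ≡ suc ((a + b) + suc b)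
  regroup = solve 2 (λ a b → (a :+ con 1) :+ (con 1 :+ (b :+ b)) := con 1 :+ ((a :+ b) :+ (con 1 :+ b))) refl

spanFuel≤1+2k : ∀ f n k → n ≤ 2 ^ k → spanFuel f n ≤ suc (2 * k)
spanFuel≤1+2k zero          n          k       _ = s≤s z≤n
spanFuel≤1+2k (suc f)       zero       k       _ = s≤s z≤n
spanFuel≤1+2k (suc f)       (suc zero) k       _ = s≤s z≤n
spanFuel≤1+2k (suc f) (suc (suc n)) zero (s≤s ())
spanFuel≤1+2k (suc f) n@(suc (suc _)) (suc k) n≤2^[1+k] =
  subst (2 + spanFuel f ⌈ n /2⌉ ≤_) (cong suc (sym (*-suc 2 k)))
        (s≤s (s≤s (spanFuel≤1+2k f ⌈ n /2⌉ k (n≤2*m⇒⌈n/2⌉≤m n≤2^[1+k]))))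

work-linear : ∀ n → work n ≤ 3 * suc n
work-linear n = begin
    work n         ≤⟨ workFuel≤1+n+n n n ⟩
    suc (n + n)    ≤⟨ s≤s (+-monoʳ-≤ n (n≤1+n n)) ⟩
    suc n + suc n  ≤⟨ +-monoʳ-≤ (suc n) (m≤m+n (suc n) _) ⟩
    3 * suc n      ∎
  where open ≤-Reasoning

span-logarithmic : ∀ n → span n ≤ 3 * suc ⌊log₂ n ⌋
span-logarithmic n = ≤-trans (spanFuel≤1+2k n n (suc L) (<⇒≤ (n<2^[1+⌊log₂n⌋] n)))
                             (+-monoˡ-≤ (2 * suc L) (s≤s z≤n))
  where L = ⌊log₂ n ⌋

lemma1 : (∃ λ c → (∀ n → work n ≤ c * suc n) × (∀ n → span n ≤ c * suc ⌊log₂ n ⌋))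
         × (∀ (n : ℕ) (A : Array) → countPred A n ≤ countSucc A n →
            ∀ t → t ≤ n → SuccessorHeavy (preprocess n A) t)
lemma1 = (3 , work-linear , span-logarithmic) , successorHeavy
  where
  successorHeavy : ∀ n A → countPred A n ≤ countSucc A n →
                   ∀ t → t ≤ n → SuccessorHeavy (preprocess n A) t
  successorHeavy n A balanced =
    preprocessFuel-successorHeavy n n A ≤-refl (balanced⇒HalfSuccessors A n balanced)
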